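{- For any bridge/path cubical set $\Gamma$ and every bridge/path cube $W$, the map $\kappa_{\Gamma,W}:(\flat\Gamma)(W)\to\Gamma(W)$ is injective; i.e. $\kappa:\flat\Gamma\to\Gamma$ is a levelwise injective presheaf map.
   Context: $\mathrm{BPCube}$: pairs $W=(W_B,W_P)$ of disjoint finite sets of names (bridge and path variables); face maps $\varphi:V\to W$ assign to bridge variables values in $\{0,1\}\cup V_B$ and to path variables values in $\{0,1\}\cup V_B\cup V_P$; composition by substitution. Let $\natural W:=(W_B,\emptyset)$, with $i\langle\natural\varphi\rangle=i\langle\varphi\rangle$ for bridge variables $i$, and $\varsigma_W:W\to\natural W$ the face map sending each bridge variable to itself. Then $\flat\Gamma:=\Gamma\circ\natural$ and $\kappa_{\Gamma,W}:=\Gamma(\varsigma_W):\Gamma(\natural W)\to\Gamma(W)$. -}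

module Defs where

open import Data.Nat using (ℕ)
open import Data.Fin using (Fin)
open import Data.Vec using (Vec; tabulate; lookup)
open import Data.Vec using () renaming (map to vmap)
open import Relation.Binary.PropositionalEquality using (_≡_)

-- A bridge/path cube W = (W_B , W_P): the names are represented by
-- Fin (number of bridge vars) and Fin (number of path vars).
record Cube : Set where
  constructor cube
  field
    nB : ℕ
    nP : ℕ
open Cube public

data BVal (V : Cube) : Set where
  b0 b1 : BVal V
  bvar  : Fin (nB V) → BVal V

data PVal (V : Cube) : Set where
  p0 p1 : PVal V
  pbvar : Fin (nB V) → PVal V
  ppvar : Fin (nP V) → PVal V

-- A face map φ : V → W assigns to each bridge variable of W a value in
-- {0,1} ∪ V_B and to each path variable of W a value in {0,1} ∪ V_B ∪ V_P.
record Hom (V W : Cube) : Set where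
  constructor hom
  field
    bridges : Vec (BVal V) (nB W)
    paths   : Vec (PVal V) (nP W)
open Hom public

idH : (W : Cube) → Hom W W
idH W = hom (tabulate bvar) (tabulate ppvar)

bToP : {V : Cube} → BVal V → PVal V
bToP b0 = p0
bToP b1 = p1
bToP (bvar i) = pbvar i

substB : {U V : Cube} → Hom U V → BVal V → BVal U
substB φ b0 = b0
substB φ b1 = b1
substB φ (bvar i) = lookup (bridges φ) i

substP : {U V : Cube} → Hom U V → PVal V → PVal U
substP φ p0 = p0
substP φ p1 = p1
substP φ (pbvar i) = bToP (lookup (bridges φ) i)
substP φ (ppvar j) = lookup (paths φ) j

_∘H_ : {U V W : Cube} → Hom V W → Hom U V → Hom U W
ψ ∘H φ = hom (vmap (substB φ) (bridges ψ)) (vmap (substP φ) (paths ψ))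

record BPSet : Set₁ where
  field
    obj   : Cube → Set
    act   : {V W : Cube} → Hom V W → obj W → obj V
    act-id   : {W : Cube} (x : obj W) → act (idH W) x ≡ x
    act-comp : {U V W : Cube} (ψ : Hom V W) (φ : Hom U V) (x : obj W) →
               act (ψ ∘H φ) x ≡ act φ (act ψ x)
open BPSet public

♮ : Cube → Cube
♮ W = cube (nB W) 0

ς : (W : Cube) → Hom W (♮ W)
ς W = hom (tabulate bvar) Data.Vec.[]

♭obj : BPSet → Cube → Set
♭obj Γ W = obj Γ (♮ W)

κ : (Γ : BPSet) (W : Cube) → ♭obj Γ W → obj Γ W
κ Γ W = act Γ (ς W)

module Submission where

-- Idea: κ_{Γ,W} = Γ(ς_W) is injective because ς_W : W → ♮W has a
-- section in BPCube.  Let ρ_W : ♮W → W send every bridge variable to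
-- itself and every path variable to 0; substitution gives ς_W ∘ ρ_W = id.
-- Contravariant functoriality turns this into Γ(ρ_W) ∘ Γ(ς_W) = id, so
-- Γ(ς_W) has a left inverse and is therefore injective.

open import Defs
open import Relation.Binary.PropositionalEquality
  using (_≡_; sym; cong; module ≡-Reasoning)
open import Function.Definitions using (Injective)
open import Data.Vec using (tabulate; lookup; replicate; []; map)
open import Data.Vec.Properties using (tabulate-∘; lookup∘tabulate; tabulate-cong)

-- If ψ ∘ φ = id then Γ(φ) is a left inverse of Γ(ψ): presheaves send
-- split epimorphisms of cubes to split monomorphisms of sets.
act-retraction : (Γ : BPSet) {V W : Cube} (ψ : Hom V W) (φ : Hom W V) →
                 ψ ∘H φ ≡ idH W → ∀ x → act Γ φ (act Γ ψ x) ≡ x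
act-retraction Γ {W = W} ψ φ split x = begin
  act Γ φ (act Γ ψ x)  ≡⟨ sym (act-comp Γ ψ φ x) ⟩
  act Γ (ψ ∘H φ) x     ≡⟨ cong (λ h → act Γ h x) split ⟩
  act Γ (idH W) x      ≡⟨ act-id Γ x ⟩
  x                    ∎
  where open ≡-Reasoning

act-injective : (Γ : BPSet) {V W : Cube} (ψ : Hom V W) (φ : Hom W V) →
                ψ ∘H φ ≡ idH W → Injective _≡_ _≡_ (act Γ ψ)
act-injective Γ ψ φ split {x} {y} ψx≡ψy = begin
  x                    ≡⟨ sym (act-retraction Γ ψ φ split x) ⟩
  act Γ φ (act Γ ψ x)  ≡⟨ cong (act Γ φ) ψx≡ψy ⟩
  act Γ φ (act Γ ψ y)  ≡⟨ act-retraction Γ ψ φ split y ⟩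
  y                    ∎
  where open ≡-Reasoning

ρ : (W : Cube) → Hom (♮ W) W
ρ W = hom (tabulate bvar) (replicate (nP W) p0)

-- ρ_W is a section of ς_W: substituting ρ_W into the bridge variables of
-- ♮W returns each variable to itself (and ♮W has no path variables).
ς∘ρ≡id : (W : Cube) → ς W ∘H ρ W ≡ idH (♮ W)
ς∘ρ≡id W = cong (λ bs → hom bs []) (begin
  map (substB (ρ W)) (tabulate bvar)           ≡⟨ sym (tabulate-∘ (substB (ρ W)) bvar) ⟩
  tabulate (λ i → lookup (tabulate bvar) i)    ≡⟨ tabulate-cong (lookup∘tabulate bvar) ⟩
  tabulate bvar                                ∎)
  where open ≡-Reasoning

lemma4p28 : (Γ : BPSet) (W : Cube) → Injective _≡_ _≡_ (κ Γ W)
lemma4p28 Γ W = act-injective Γ (ς W) (ρ W) (ς∘ρ≡id W)
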